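{- Let $G=(V\cup\{O\},E)$ be a connected, unweighted, undirected graph, where $V$ is a set of $n$ terminals and $O\notin V$ is the depot, and let $k\in[1,n]$ be an integer tour capacity. Let $\mathrm{OPT}$ be an optimal solution to the graphic CVRP on this instance, let $T=z_1z_2\dots z_p$ be a tour in $\mathrm{OPT}$, let $U\subseteq V$ be the set of terminals covered by $T$, assumed nonempty, and let $D=\sum_{v\in U}\mathrm{dist}(v)$. Then \[ \mathrm{cost}(T)\geq \frac{2D}{|U|}+\frac{|U|}{2}-\frac{1}{2|U|}. \]
   Context: For $v\in V$, $\mathrm{dist}(v)$ is the number of edges on a shortest $v$-to-$O$ path in $G$. A tour is a walk $z_1z_2\dots z_p$ in $G$ with $z_1=z_p=O$ and $(z_i,z_{i+1})\in E$ for all $i\in[1,p-1]$; its cost $\mathrm{cost}(T)=p-1$ is the number of edges traversed (with multiplicity). The graphic CVRP asks for a collection of tours together with an assignment of each terminal to exactly one tour that visits it (that tour covers the terminal), such that each tour covers at most $k$ terminals, minimizing the total cost of the tours; an optimal solution is one of minimum total cost. -}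

module Defs where

open import Data.Nat using (ℕ; zero; suc; _+_; _*_; _∸_; _≤_)
open import Data.Fin using (Fin; zero; suc; _≟_)
open import Data.List using (List; []; _∷_; length; map; filter; head; last; lookup; allFin)
open import Data.Nat.ListAction using (sum)
open import Data.List.Relation.Unary.All using (All)
open import Data.List.Relation.Unary.Linked using (Linked)
open import Data.List.Membership.Propositional using (_∈_)
open import Data.Maybe using (just)
open import Data.Product using (Σ; _×_; ∃)
open import Relation.Binary.PropositionalEquality using (_≡_)
open import Relation.Nullary using (¬_)

-- Vertex set V ∪ {O} with n terminals: Fin (suc n).
-- The depot O is `zero`; terminal i : Fin n is the vertex `suc i`.
Vtx : ℕ → Set
Vtx n = Fin (suc n)

depot : ∀ {n} → Vtx n
depot = zero

Rel : ℕ → Set₁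
Rel n = Vtx n → Vtx n → Set

IsSimpleUndirected : ∀ {n} → Rel n → Set
IsSimpleUndirected {n} E = (∀ (u v : Vtx n) → E u v → E v u) × (∀ (u : Vtx n) → ¬ E u u)

IsWalk : ∀ {n} → Rel n → Vtx n → Vtx n → List (Vtx n) → Set
IsWalk E u v zs = Linked E zs × head zs ≡ just u × last zs ≡ just v

edges : ∀ {n} → List (Vtx n) → ℕ
edges zs = length zs ∸ 1

Connected : ∀ {n} → Rel n → Set
Connected {n} E = ∀ (v : Vtx n) → ∃ λ zs → IsWalk E v depot zs

IsDist : ∀ {n} → Rel n → Vtx n → ℕ → Set
IsDist E v d = (∃ λ zs → IsWalk E v depot zs × edges zs ≡ d)
             × (∀ zs → IsWalk E v depot zs → d ≤ edges zs)

IsTour : ∀ {n} → Rel n → List (Vtx n) → Set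
IsTour E zs = IsWalk E depot depot zs

cost : ∀ {n} → List (Vtx n) → ℕ
cost = edges

record Solution (n : ℕ) (E : Rel n) (k : ℕ) : Set where
  field
    tours  : List (List (Vtx n))
    valid  : All (IsTour E) tours
    assign : Fin n → Fin (length tours)
    visits : ∀ (i : Fin n) → suc i ∈ lookup tours (assign i)

  covered : Fin (length tours) → List (Fin n)
  covered j = filter (λ i → assign i ≟ j) (allFin n)

  field
    capacity : ∀ (j : Fin (length tours)) → length (covered j) ≤ k

open Solution public

totalCost : ∀ {n E k} → Solution n E k → ℕ
totalCost S = sum (map cost (tours S))

IsOptimal : ∀ {n E k} → Solution n E k → Set
IsOptimal {n} {E} {k} S = ∀ (S' : Solution n E k) → totalCost S ≤ totalCost S'

module Submission where

-- Let c be the cost of the tour. The distance to the depot is 0 at the depot and changes by at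
-- most one along an edge, so a terminal visited at position i of the tour has dist ≤ min(i, c − i);
-- distinct terminals occupy distinct positions. Multiplied out, the claim
-- 4D + |U|² ≤ 2|U|c + 1 therefore follows from the same bound for any set of |U| positions in
-- {0, …, c} weighted by min(i, c − i). That bound holds by induction on c: deleting the two ends
-- (weight 0) loses at most two positions and lowers the weight of every inner position by one.

open import Defs
open import Data.Nat.Properties hiding (_≟_)
open import Algebra.Properties.CommutativeMonoid.Sum +-0-commutativeMonoid
  using (sum-syntax; sum-init-last; sum-cong-≗; sum-replicate-zero; ∑-distrib-+)
  renaming (sum to ∑)
open import Data.Bool using (if_then_else_)
open import Data.Fin using (Fin; zero; suc; toℕ; inject₁; fromℕ; _≟_)
open import Data.Fin.Properties using (toℕ-inject₁; toℕ-fromℕ; toℕ<n)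
import Data.Fin.Properties as Fin
open import Data.List using (List; []; _∷_; map; length; head; last; lookup; allFin)
open import Data.List.Membership.Propositional using (_∈_)
open import Data.List.Membership.Propositional.Properties using (∈-lookup; ∈-filter⁻)
open import Data.List.Properties using (length-map; map-∘)
open import Data.List.Relation.Unary.All as All using (All; []; _∷_)
import Data.List.Relation.Unary.All.Properties as All
open import Data.List.Relation.Unary.Any using (index)
open import Data.List.Relation.Unary.Any.Properties using (lookup-index)
open import Data.List.Relation.Unary.Linked using (Linked; [-]; _∷_)
open import Data.List.Relation.Unary.Unique.Propositional using (Unique; []; _∷_)
import Data.List.Relation.Unary.Unique.Propositional.Properties as Unique
open import Data.Maybe using (just)
open import Data.Nat using (ℕ; zero; suc; _+_; _*_; _∸_; _≤_; _⊓_; z≤n; s≤s; s≤s⁻¹)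
open import Data.Nat.ListAction using (sum)
open import Data.Nat.Tactic.RingSolver using (solve-∀)
open import Data.Product using (∃; _×_; _,_; proj₁; proj₂)
open import Data.Vec.Functional using (Vector; tail)
open import Function using (_∘_)
open import Relation.Binary.Definitions using (DecidableEquality)
open import Relation.Binary.PropositionalEquality
open import Relation.Nullary using (Dec; does; yes; no; contradiction)

nearEnd : ℕ → ℕ → ℕ
nearEnd c i = i ⊓ (c ∸ i)

nearEnd-inner : ∀ {c i} → i ≤ c → nearEnd (2 + c) (suc i) ≡ suc (nearEnd c i)
nearEnd-inner {c} {i} i≤c = cong (λ t → suc i ⊓ t) (+-∸-assoc 1 i≤c)

nearEnd-end : ∀ c → nearEnd c c ≡ 0
nearEnd-end c = trans (cong (c ⊓_) (n∸n≡0 c)) (⊓-zeroʳ c)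

inner : ∀ {A : Set} {c} → Vector A (3 + c) → Vector A (suc c)
inner t = t ∘ suc ∘ inject₁

∑-peel : ∀ {c} (t : Vector ℕ (3 + c)) → ∑ t ≡ t zero + (∑ (inner t) + t (fromℕ (2 + c)))
∑-peel t = cong (t zero +_) (sum-init-last (tail t))

∑-nearEnd-peel : ∀ {c} (g : Vector ℕ (3 + c)) →
  ∑[ i < 3 + c ] (g i * nearEnd (2 + c) (toℕ i))
    ≡ ∑[ i < suc c ] (inner g i * nearEnd c (toℕ i)) + ∑ (inner g)
∑-nearEnd-peel {c} g = begin
    ∑ t
  ≡⟨ ∑-peel t ⟩
    t zero + (∑ (inner t) + t (fromℕ (2 + c)))
  ≡⟨ cong₂ (λ a b → a + (∑ (inner t) + b)) (*-zeroʳ (g zero)) last-term≡0 ⟩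
    ∑ (inner t) + 0
  ≡⟨ +-identityʳ (∑ (inner t)) ⟩
    ∑ (inner t)
  ≡⟨ sum-cong-≗ inner-term ⟩
    ∑[ i < suc c ] (inner g i * nearEnd c (toℕ i) + inner g i)
  ≡⟨ ∑-distrib-+ (λ i → inner g i * nearEnd c (toℕ i)) (inner g) ⟩
    ∑[ i < suc c ] (inner g i * nearEnd c (toℕ i)) + ∑ (inner g) ∎
  where
  open ≡-Reasoning
  t : Vector ℕ (3 + c)
  t i = g i * nearEnd (2 + c) (toℕ i)
  last-term≡0 : t (fromℕ (2 + c)) ≡ 0
  last-term≡0 = begin
      g (fromℕ (2 + c)) * nearEnd (2 + c) (toℕ (fromℕ (2 + c)))
    ≡⟨ cong (λ i → g (fromℕ (2 + c)) * nearEnd (2 + c) i) (toℕ-fromℕ (2 + c)) ⟩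
      g (fromℕ (2 + c)) * nearEnd (2 + c) (2 + c)
    ≡⟨ cong (g (fromℕ (2 + c)) *_) (nearEnd-end (2 + c)) ⟩
      g (fromℕ (2 + c)) * 0
    ≡⟨ *-zeroʳ (g (fromℕ (2 + c))) ⟩
      0 ∎
  inner-term : ∀ i → inner t i ≡ inner g i * nearEnd c (toℕ i) + inner g i
  inner-term i = begin
      inner g i * nearEnd (2 + c) (suc (toℕ (inject₁ i)))
    ≡⟨ cong (λ j → inner g i * nearEnd (2 + c) (suc j)) (toℕ-inject₁ i) ⟩
      inner g i * nearEnd (2 + c) (suc (toℕ i))
    ≡⟨ cong (inner g i *_) (nearEnd-inner (s≤s⁻¹ (toℕ<n i))) ⟩
      inner g i * suc (nearEnd c (toℕ i))
    ≡⟨ trans (*-suc (inner g i) _) (+-comm (inner g i) _) ⟩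
      inner g i * nearEnd c (toℕ i) + inner g i ∎

∑-indicator-≤ : ∀ {N} (g : Vector ℕ N) → (∀ i → g i ≤ 1) → ∑ g ≤ N
∑-indicator-≤ {zero} g g≤1 = z≤n
∑-indicator-≤ {suc N} g g≤1 = +-mono-≤ (g≤1 zero) (∑-indicator-≤ (tail g) (g≤1 ∘ suc))

-- e₀ and e₁ indicate the two ends; each of the U inner positions gains one unit of weight.
nearEnd-bound-step : ∀ {c W U e₀ e₁} →
  4 * W + U * U ≤ 2 * U * c + 1 → e₀ ≤ 1 → e₁ ≤ 1 → U ≤ suc c →
  4 * (W + U) + (e₀ + (U + e₁)) * (e₀ + (U + e₁)) ≤ 2 * (e₀ + (U + e₁)) * (2 + c) + 1
nearEnd-bound-step {c} {W} {U} {e₀} {e₁} bound e₀≤1 e₁≤1 U≤1+c = begin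
    4 * (W + U) + (e₀ + (U + e₁)) * (e₀ + (U + e₁))
  ≡⟨ expand-lhs W U e₀ e₁ ⟩
    (4 * W + U * U) + (4 * U + (e₀ + e₁) * ((e₀ + e₁) + 2 * U))
  ≤⟨ +-mono-≤ bound (+-monoʳ-≤ (4 * U) (*-monoʳ-≤ (e₀ + e₁) ends+2U≤)) ⟩
    (2 * U * c + 1) + (4 * U + (e₀ + e₁) * (2 * (2 + c)))
  ≡⟨ expand-rhs U c e₀ e₁ ⟩
    2 * (e₀ + (U + e₁)) * (2 + c) + 1 ∎
  where
  open ≤-Reasoning
  expand-lhs : ∀ W U e₀ e₁ → 4 * (W + U) + (e₀ + (U + e₁)) * (e₀ + (U + e₁))
    ≡ (4 * W + U * U) + (4 * U + (e₀ + e₁) * ((e₀ + e₁) + 2 * U))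
  expand-lhs = solve-∀
  expand-rhs : ∀ U c e₀ e₁ → (2 * U * c + 1) + (4 * U + (e₀ + e₁) * (2 * (2 + c)))
    ≡ 2 * (e₀ + (U + e₁)) * (2 + c) + 1
  expand-rhs = solve-∀
  ends+2U≤ : (e₀ + e₁) + 2 * U ≤ 2 * (2 + c)
  ends+2U≤ = begin
      (e₀ + e₁) + 2 * U   ≤⟨ +-mono-≤ (+-mono-≤ e₀≤1 e₁≤1) (*-monoʳ-≤ 2 U≤1+c) ⟩
      2 + 2 * suc c       ≡⟨ *-distribˡ-+ 2 1 (suc c) ⟨
      2 * (2 + c)         ∎

nearEnd-bound : ∀ c (g : Vector ℕ (suc c)) → (∀ i → g i ≤ 1) →
  4 * ∑[ i < suc c ] (g i * nearEnd c (toℕ i)) + ∑ g * ∑ g ≤ 2 * ∑ g * c + 1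
nearEnd-bound zero g g≤1 with g zero | g≤1 zero
... | _ | z≤n = z≤n
... | _ | s≤s z≤n = s≤s z≤n
nearEnd-bound (suc zero) g g≤1 with g zero | g≤1 zero | g (suc zero) | g≤1 (suc zero)
... | _ | z≤n     | _ | z≤n     = z≤n
... | _ | z≤n     | _ | s≤s z≤n = s≤s z≤n
... | _ | s≤s z≤n | _ | z≤n     = s≤s z≤n
... | _ | s≤s z≤n | _ | s≤s z≤n = s≤s (s≤s (s≤s (s≤s z≤n)))
nearEnd-bound (suc (suc c)) g g≤1 =
  subst₂ (λ W U → 4 * W + U * U ≤ 2 * U * (2 + c) + 1)
    (sym (∑-nearEnd-peel g)) (sym (∑-peel g))
    (nearEnd-bound-step {W = ∑[ i < suc c ] (inner g i * nearEnd c (toℕ i))}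
      (nearEnd-bound c (inner g) (g≤1 ∘ suc ∘ inject₁)) (g≤1 zero) (g≤1 (fromℕ (2 + c)))
      (∑-indicator-≤ (inner g) (g≤1 ∘ suc ∘ inject₁)))

δ : ∀ {N} → Fin N → Fin N → ℕ
δ a i = if does (a ≟ i) then 1 else 0

∑-δ : ∀ {N} (a : Fin N) (h : Vector ℕ N) → ∑[ i < N ] (δ a i * h i) ≡ h a
∑-δ {suc N} zero h =
  trans (cong₂ _+_ (+-identityʳ (h zero)) (sum-replicate-zero N)) (+-identityʳ (h zero))
∑-δ {suc N} (suc a) h = ∑-δ a (tail h)

multiplicity : ∀ {N} → List (Fin N) → Fin N → ℕ
multiplicity [] i = 0
multiplicity (p ∷ ps) i = δ p i + multiplicity ps i

sum-map≡∑-multiplicity : ∀ {N} (h : Vector ℕ N) (ps : List (Fin N)) →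
  sum (map h ps) ≡ ∑[ i < N ] (multiplicity ps i * h i)
sum-map≡∑-multiplicity {N} h [] = sym (sum-replicate-zero N)
sum-map≡∑-multiplicity {N} h (p ∷ ps) = begin
    h p + sum (map h ps)
  ≡⟨ cong₂ _+_ (sym (∑-δ p h)) (sum-map≡∑-multiplicity h ps) ⟩
    ∑[ i < N ] (δ p i * h i) + ∑[ i < N ] (multiplicity ps i * h i)
  ≡⟨ ∑-distrib-+ (λ i → δ p i * h i) (λ i → multiplicity ps i * h i) ⟨
    ∑[ i < N ] (δ p i * h i + multiplicity ps i * h i)
  ≡⟨ sum-cong-≗ (λ i → *-distribʳ-+ (h i) (δ p i) (multiplicity ps i)) ⟨
    ∑[ i < N ] (multiplicity (p ∷ ps) i * h i) ∎
  where open ≡-Reasoning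

multiplicity-absent : ∀ {N} {i : Fin N} {ps} → All (i ≢_) ps → multiplicity ps i ≡ 0
multiplicity-absent [] = refl
multiplicity-absent {i = i} {p ∷ _} (i≢p ∷ i∉ps) with p ≟ i
... | yes p≡i = contradiction (sym p≡i) i≢p
... | no _ = multiplicity-absent i∉ps

multiplicity-unique : ∀ {N} {ps : List (Fin N)} → Unique ps → ∀ i → multiplicity ps i ≤ 1
multiplicity-unique [] i = z≤n
multiplicity-unique {ps = p ∷ _} (p∉ps ∷ unique) i with p ≟ i
... | yes refl = ≤-reflexive (cong suc (multiplicity-absent p∉ps))
... | no _ = multiplicity-unique unique i

sum-map-1≡length : ∀ {A : Set} (xs : List A) → sum (map (λ _ → 1) xs) ≡ length xs
sum-map-1≡length [] = refl
sum-map-1≡length (_ ∷ xs) = cong suc (sum-map-1≡length xs)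

unique-positions-bound : ∀ {c} (ps : List (Fin (suc c))) → Unique ps →
  4 * sum (map (nearEnd c ∘ toℕ) ps) + length ps * length ps ≤ 2 * length ps * c + 1
unique-positions-bound {c} ps unique =
  subst₂ (λ W U → 4 * W + U * U ≤ 2 * U * c + 1) (sym weights) mass
    (nearEnd-bound c (multiplicity ps) (multiplicity-unique unique))
  where
  weights : sum (map (nearEnd c ∘ toℕ) ps) ≡ ∑[ i < suc c ] (multiplicity ps i * nearEnd c (toℕ i))
  weights = sum-map≡∑-multiplicity (nearEnd c ∘ toℕ) ps
  mass : ∑ (multiplicity ps) ≡ length ps
  mass = begin
      ∑ (multiplicity ps)
    ≡⟨ sum-cong-≗ (λ i → *-identityʳ (multiplicity ps i)) ⟨
      ∑[ i < suc c ] (multiplicity ps i * 1)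
    ≡⟨ sum-map≡∑-multiplicity (λ _ → 1) ps ⟨
      sum (map (λ _ → 1) ps)
    ≡⟨ sum-map-1≡length ps ⟩
      length ps ∎
    where open ≡-Reasoning

sum-map-mono : ∀ {A : Set} {f g : A → ℕ} {xs} →
  All (λ x → f x ≤ g x) xs → sum (map f xs) ≤ sum (map g xs)
sum-map-mono [] = z≤n
sum-map-mono (f≤g ∷ fs≤gs) = +-mono-≤ f≤g (sum-map-mono fs≤gs)

Unique-map⁺-on : ∀ {A B : Set} {P : A → Set} {f : A → B} {xs} →
  (∀ {x y} → P x → P y → f x ≡ f y → x ≡ y) → All P xs → Unique xs → Unique (map f xs)
Unique-map⁺-on inj [] [] = []
Unique-map⁺-on inj (px ∷ pxs) (x∉xs ∷ unique) =
  All.map⁺ (All.zipWith (λ (py , x≢y) fx≡fy → x≢y (inj px py fx≡fy)) (pxs , x∉xs))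
  ∷ Unique-map⁺-on inj pxs unique

module _ {A : Set} {R : A → A → Set} (f : A → ℕ) where

  lookup≤head+index : (∀ {x y} → R x y → f y ≤ suc (f x)) →
    ∀ {xs a} → Linked R xs → head xs ≡ just a → (i : Fin (length xs)) →
    f (lookup xs i) ≤ f a + toℕ i
  lookup≤head+index step {x ∷ _} _ refl zero = m≤m+n (f x) 0
  lookup≤head+index step {x ∷ y ∷ ys} (r ∷ linked) refl (suc i) = begin
      f (lookup (y ∷ ys) i)  ≤⟨ lookup≤head+index step linked refl i ⟩
      f y + toℕ i            ≤⟨ +-monoˡ-≤ (toℕ i) (step r) ⟩
      suc (f x + toℕ i)      ≡⟨ +-suc (f x) (toℕ i) ⟨
      f x + suc (toℕ i)      ∎
    where open ≤-Reasoning

  lookup≤last+remaining : (∀ {x y} → R x y → f x ≤ suc (f y)) →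
    ∀ {xs b} → Linked R xs → last xs ≡ just b → (i : Fin (length xs)) →
    f (lookup xs i) ≤ f b + (length xs ∸ 1 ∸ toℕ i)
  lookup≤last+remaining step {x ∷ []} _ refl zero = m≤m+n (f x) 0
  lookup≤last+remaining step {x ∷ y ∷ ys} {b} (r ∷ linked) last≡b zero = begin
      f x                      ≤⟨ step r ⟩
      suc (f y)                ≤⟨ s≤s (lookup≤last+remaining step linked last≡b zero) ⟩
      suc (f b + length ys)    ≡⟨ +-suc (f b) (length ys) ⟨
      f b + suc (length ys)    ∎
    where open ≤-Reasoning
  lookup≤last+remaining step {_ ∷ _ ∷ _} (_ ∷ linked) last≡b (suc i) =
    lookup≤last+remaining step linked last≡b i

module _ {A : Set} (_≟ᴬ_ : DecidableEquality A) where
  open import Data.List.Membership.DecPropositional _≟ᴬ_ using (_∈?_)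

  -- An absent element gets the junk position zero.
  position : (z : A) (zs : List A) → A → Fin (length (z ∷ zs))
  position z zs x with x ∈? z ∷ zs
  ... | yes x∈ = index x∈
  ... | no _ = zero

  lookup-position : ∀ {z zs x} → x ∈ z ∷ zs → lookup (z ∷ zs) (position z zs x) ≡ x
  lookup-position {z} {zs} {x} x∈ with x ∈? z ∷ zs
  ... | yes x∈′ = sym (lookup-index x∈′)
  ... | no x∉ = contradiction x∈ x∉

module _ {n} (E : Rel n) (dist : Fin n → ℕ) (isDist : ∀ v → IsDist E (suc v) (dist v)) where

  distance : Vtx n → ℕ
  distance zero = 0
  distance (suc v) = dist v

  shortest-walk : ∀ y → ∃ λ ws → IsWalk E y depot ws × edges ws ≡ distance y
  shortest-walk zero = depot ∷ [] , ([-] , refl , refl) , refl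
  shortest-walk (suc v) = proj₁ (isDist v)

  distance-step : ∀ {x y} → E x y → distance x ≤ suc (distance y)
  distance-step {zero} _ = z≤n
  distance-step {suc v} {y} e with shortest-walk y
  ... | y ∷ ws , (linked , refl , last≡depot) , length≡ =
    subst (λ d → dist v ≤ suc d) length≡ (proj₂ (isDist v) _ (e ∷ linked , refl , last≡depot))

  distance≤nearEnd : (∀ u v → E u v → E v u) → ∀ {zs} → IsTour E zs → (i : Fin (length zs)) →
    distance (lookup zs i) ≤ nearEnd (cost zs) (toℕ i)
  distance≤nearEnd symmetric (linked , head≡depot , last≡depot) i =
    ⊓-glb (lookup≤head+index distance (λ e → distance-step (symmetric _ _ e)) linked head≡depot i)
          (lookup≤last+remaining distance distance-step linked last≡depot i)

  tour-bound : (∀ u v → E u v → E v u) → ∀ {zs} → IsTour E zs →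
    (L : List (Fin n)) → Unique L → All (λ v → suc v ∈ zs) L →
    4 * sum (map dist L) + length L * length L ≤ 2 * length L * cost zs + 1
  tour-bound symmetric {z ∷ zs} tour L unique visited = begin
      4 * sum (map dist L) + length L * length L
    ≤⟨ +-monoˡ-≤ (length L * length L) (*-monoʳ-≤ 4 dist≤nearEnd) ⟩
      4 * sum (map w ps) + length L * length L
    ≡⟨ cong (λ U → 4 * sum (map w ps) + U * U) (length-map pos L) ⟨
      4 * sum (map w ps) + length ps * length ps
    ≤⟨ unique-positions-bound ps (Unique-map⁺-on pos-injective visited unique) ⟩
      2 * length ps * cost (z ∷ zs) + 1
    ≡⟨ cong (λ U → 2 * U * cost (z ∷ zs) + 1) (length-map pos L) ⟩
      2 * length L * cost (z ∷ zs) + 1 ∎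
    where
    open ≤-Reasoning
    pos : Fin n → Fin (length (z ∷ zs))
    pos v = position _≟_ z zs (suc v)
    ps : List (Fin (length (z ∷ zs)))
    ps = map pos L
    w : Fin (length (z ∷ zs)) → ℕ
    w = nearEnd (cost (z ∷ zs)) ∘ toℕ
    pos-injective : ∀ {u v} → suc u ∈ z ∷ zs → suc v ∈ z ∷ zs → pos u ≡ pos v → u ≡ v
    pos-injective u∈ v∈ pos≡ = Fin.suc-injective
      (trans (sym (lookup-position _≟_ u∈))
             (trans (cong (lookup (z ∷ zs)) pos≡) (lookup-position _≟_ v∈)))
    visited-dist≤w : ∀ {v} → suc v ∈ z ∷ zs → dist v ≤ w (pos v)
    visited-dist≤w {v} v∈ =
      subst (λ x → distance x ≤ w (pos v)) (lookup-position _≟_ v∈)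
        (distance≤nearEnd symmetric tour (pos v))
    dist≤nearEnd : sum (map dist L) ≤ sum (map w ps)
    dist≤nearEnd =
      ≤-trans (sum-map-mono (All.map visited-dist≤w visited)) (≤-reflexive (cong sum (map-∘ L)))

lemma3p1 : (n : ℕ) (E : Rel n) → IsSimpleUndirected E → Connected E →
    (k : ℕ) → 1 ≤ k → k ≤ n →
    (dist : Fin n → ℕ) → (∀ (v : Fin n) → IsDist E (suc v) (dist v)) →
    (OPT : Solution n E k) → IsOptimal OPT →
    (j : Fin (length (tours OPT))) →
    1 ≤ length (covered OPT j) →
    4 * sum (map dist (covered OPT j)) + length (covered OPT j) * length (covered OPT j)
      ≤ 2 * length (covered OPT j) * cost (lookup (tours OPT) j) + 1
lemma3p1 n E (symmetric , _) _ _ _ _ dist isDist OPT _ j _ =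
  tour-bound E dist isDist symmetric (All.lookup (valid OPT) (∈-lookup j))
    (covered OPT j) (Unique.filter⁺ assigned-to-j? (Unique.allFin⁺ n)) (All.tabulate visits-j)
  where
  assigned-to-j? : ∀ v → Dec (assign OPT v ≡ j)
  assigned-to-j? v = assign OPT v ≟ j
  visits-j : ∀ {v} → v ∈ covered OPT j → suc v ∈ lookup (tours OPT) j
  visits-j v∈ = subst (λ t → suc _ ∈ lookup (tours OPT) t)
    (proj₂ (∈-filter⁻ assigned-to-j? {xs = allFin n} v∈)) (visits OPT _)
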